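{- Let $n \in \mathbb{N}$ and let $k$ be an integer with $0 \le k \le 2^n - 1$, with base-2 representation $k_n k_{n-1} \ldots k_1$ ($k_n$ most significant, $k_1$ least significant, so $k = \sum_{j=1}^n k_j 2^{j-1}$). Define Boolean functions $H^k_j : \{0,1\}^n \to \{0,1\}$ for $j = 0, 1, \ldots, n$ recursively by $H^k_0(\vec{x}) = 0$ and \[ H^k_j(\vec{x}) = x_j \,\square_j\, H^k_{j-1}(\vec{x}), \qquad j = 1, \ldots, n, \] where $\square_j$ is $\wedge$ if $k_j = 0$ and $\vee$ if $k_j = 1$. Then for every $\vec{x} = (x_1, \ldots, x_n) \in \{0,1\}^n$, \[ H^k_n(\overline{\vec{x}}) = 1 \iff \vec{x} < k, \] where $\overline{\vec{x}} = (\neg x_1, \ldots, \neg x_n)$ is the bitwise negation of $\vec{x}$ and $\vec{x}$ is interpreted as the unsigned integer $\sum_{j=1}^n x_j 2^{j-1}$ (so $x_n$ is the most significant bit, matching $k_n$).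
   Context: Bits are identified with $\{0,1\}$ (False $=0$, True $=1$), and $\wedge$, $\vee$, $\neg$ denote the usual Boolean operations. -}

module Defs where

open import Data.Nat using (ℕ; zero; suc; _+_; _*_; _^_; _≤_; _<_; s≤s; z≤n)
open import Data.Nat.DivMod using (_/_; _%_)
open import Data.Nat.Properties using (m^n≢0; ≤-trans; n≤1+n)
open import Data.Bool using (Bool; true; false; _∧_; _∨_; not; if_then_else_)
open import Data.Fin using (Fin; fromℕ<)

-- Bit vectors x = (x_1, …, x_n) are functions Fin n → Bool;
-- index i : Fin n stands for coordinate x_{i+1}.
BitVec : ℕ → Set
BitVec n = Fin n → Bool

negV : ∀ {n} → BitVec n → BitVec n
negV x i = not (x i)

toBit : Bool → ℕ
toBit false = 0
toBit true  = 1

valUpTo : ∀ {n} → BitVec n → (j : ℕ) → j ≤ n → ℕ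
valUpTo x zero    _  = 0
valUpTo x (suc j) sj≤n =
  valUpTo x j (≤-trans (n≤1+n j) sj≤n) + toBit (x (fromℕ< sj≤n)) * 2 ^ j

val : ∀ {n} → BitVec n → ℕ
val {n} x = valUpTo x n (Data.Nat.Properties.≤-refl)

-- k_j, the j-th binary digit of k (j ≥ 1; k_j = ⌊k / 2^{j-1}⌋ mod 2),
-- given here with the 0-based index j-1.
digit : ℕ → ℕ → Bool
digit k i with (k / (2 ^ i)) {{Data.Nat.>-nonZero (Data.Nat.Properties.m^n>0 2 i)}} % 2
... | zero = false
... | suc _ = true

H : ∀ {n} → ℕ → BitVec n → (j : ℕ) → j ≤ n → Bool
H k x zero    _    = false
H k x (suc j) sj≤n =
  (if digit k j then _∨_ else _∧_) (x (fromℕ< sj≤n)) (H k x j (≤-trans (n≤1+n j) sj≤n))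

module Submission where

-- Write r_j = k mod 2^j for the number formed by the j lowest
-- binary digits of k, and v_j = Σ_{i ≤ j} x_i 2^{i-1} for the j lowest
-- digits of x.  By induction on j we show the invariant
--     H^k_j(¬x) = 1  ⇔  v_j < r_j.  Going from j to j+1 appends the digit
-- x_{j+1} to v and k_{j+1} to r (with weight M = 2^j), and since the lower
-- parts v_j, r_j are below M, comparing the extended numbers is a two-digit
-- comparison in base M: the new digits decide unless they agree, in which
-- case the old comparison decides.  That is exactly what ¬x_{j+1} □ H^k_j
-- computes: with k_{j+1} = 0 it is ∧ (true only if x_{j+1} = 0), with
-- k_{j+1} = 1 it is ∨ (true whenever x_{j+1} = 0).  For j = n we have
-- r_n = k because k < 2^n, giving the theorem.

open import Defs
open import Data.Nat using (ℕ; zero; suc; _+_; _*_; _≤_; _<_; _^_; _∸_; NonZero; z≤n; s≤s; z<s)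
open import Data.Nat.Properties
open import Data.Nat.DivMod using (_/_; _%_; m%n<n; n%1≡0; m<n⇒m%n≡m; m≡m%n+[m/n]*n; m∣n⇒o%n%m≡o%m; m%[n*o]/o≡m/o%n)
open import Data.Nat.Divisibility using (n∣m*n)
open import Data.Bool using (Bool; true; false; not; _∧_; _∨_; if_then_else_)
open import Data.Fin using (fromℕ<)
open import Data.Product using (_×_; _,_)
open import Function.Bundles using (_⇔_; mk⇔; module Equivalence)
open import Function.Properties.Equivalence using () renaming (trans to ⇔-trans)
open import Relation.Nullary using (¬_; contradiction)
open import Relation.Binary.PropositionalEquality using (_≡_; refl; sym; cong; subst; module ≡-Reasoning)

lowerDigit-< : ∀ {v r c d M} → v < M → c < d → v + c * M < r + d * M
lowerDigit-< {v} {r} {c} {d} {M} v<M c<d = begin-strict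
  v + c * M    <⟨ +-monoˡ-< (c * M) v<M ⟩
  M + c * M    ≡⟨⟩
  suc c * M    ≤⟨ *-monoˡ-≤ M c<d ⟩
  d * M        ≤⟨ m≤n+m (d * M) r ⟩
  r + d * M    ∎
  where open ≤-Reasoning

higherDigit-≮ : ∀ {v r c d M} → r < M → d < c → ¬ (v + c * M < r + d * M)
higherDigit-≮ r<M d<c v+cM<r+dM = <-asym v+cM<r+dM (lowerDigit-< r<M d<c)

sameHigh-< : ∀ {v r} c → (v < r) ⇔ (v + c < r + c)
sameHigh-< c = mk⇔ (+-monoˡ-< c) (+-cancelʳ-< c _ _)

lowDigits : ℕ → ℕ → ℕ
lowDigits k j = _%_ k (2 ^ j) {{m^n≢0 2 j}}

toBit-digit : ∀ k j .{{_ : NonZero (2 ^ j)}} → toBit (digit k j) ≡ k / 2 ^ j % 2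
toBit-digit k j with k / 2 ^ j % 2 | m%n<n (k / 2 ^ j) 2
... | zero        | _                = refl
... | suc zero    | _                = refl
... | suc (suc _) | s≤s (s≤s ())

lowDigits-suc : ∀ k j → lowDigits k (suc j) ≡ lowDigits k j + toBit (digit k j) * 2 ^ j
lowDigits-suc k j = begin
  k % (2 * M)                                 ≡⟨ m≡m%n+[m/n]*n (k % (2 * M)) M ⟩
  k % (2 * M) % M + k % (2 * M) / M * M       ≡⟨ cong (_+ k % (2 * M) / M * M) (m∣n⇒o%n%m≡o%m M (2 * M) k (n∣m*n 2)) ⟩
  k % M + k % (2 * M) / M * M                 ≡⟨ cong (λ d → k % M + d * M) (m%[n*o]/o≡m/o%n k 2 M) ⟩
  k % M + k / M % 2 * M                       ≡⟨ cong (λ d → k % M + d * M) (sym (toBit-digit k j)) ⟩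
  k % M + toBit (digit k j) * M               ∎
  where
  open ≡-Reasoning
  M = 2 ^ j
  instance
    M-nonZero : NonZero M
    M-nonZero = m^n≢0 2 j
    2M-nonZero : NonZero (2 * M)
    2M-nonZero = m^n≢0 2 (suc j)

valUpTo-< : ∀ {n} (x : BitVec n) j (p : j ≤ n) → valUpTo x j p < 2 ^ j
valUpTo-< x zero    p = z<s
valUpTo-< x (suc j) p = begin-strict
  v + b * M     <⟨ +-monoˡ-< (b * M) (valUpTo-< x j _) ⟩
  M + b * M     ≤⟨ +-monoʳ-≤ M (*-monoˡ-≤ M (toBit≤1 (x (fromℕ< p)))) ⟩
  M + 1 * M     ≡⟨⟩
  2 * M         ∎
  where
  open ≤-Reasoning
  M = 2 ^ j
  v = valUpTo x j _
  b = toBit (x (fromℕ< p))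
  toBit≤1 : ∀ a → toBit a ≤ 1
  toBit≤1 false = z≤n
  toBit≤1 true  = ≤-refl

op : Bool → Bool → Bool → Bool
op d = if d then _∨_ else _∧_

compare-step : ∀ b d h {v r M} → v < M → r < M → (h ≡ true) ⇔ (v < r) →
       (op d (not b) h ≡ true) ⇔ (v + toBit b * M < r + toBit d * M)
compare-step false false h         _   _   h⇔v<r = ⇔-trans h⇔v<r (sameHigh-< 0)
compare-step true  true  h         _   _   h⇔v<r = ⇔-trans h⇔v<r (sameHigh-< (1 * _))
compare-step false true  h {v} {r} v<M _   _     =
  mk⇔ (λ _ → lowerDigit-< {v} {r} {0} {1} v<M z<s) (λ _ → refl)
compare-step true  false h {v} {r} _   r<M _     =
  mk⇔ (λ ()) (λ v+M<r → contradiction v+M<r (higherDigit-≮ {v} {r} {1} {0} r<M z<s))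

H-compares : ∀ {n} k (x : BitVec n) j (p : j ≤ n) →
             (H k (negV x) j p ≡ true) ⇔ (valUpTo x j p < lowDigits k j)
H-compares k x zero    p = mk⇔ (λ ()) (λ v<k%1 → contradiction (subst (0 <_) (n%1≡0 k) v<k%1) λ ())
H-compares k x (suc j) p =
  subst (λ r → (H k (negV x) (suc j) p ≡ true) ⇔ (valUpTo x (suc j) p < r))
        (sym (lowDigits-suc k j))
        (compare-step (x (fromℕ< p)) (digit k j) (H k (negV x) j p′)
                      (valUpTo-< x j p′) (m%n<n k (2 ^ j) {{m^n≢0 2 j}}) (H-compares k x j p′))
  where p′ = ≤-trans (n≤1+n j) p

proposition2 : (n k : ℕ) → k ≤ 2 ^ n ∸ 1 → (x : BitVec n) →
    (H k (negV x) n ≤-refl ≡ true → val x < k) × (val x < k → H k (negV x) n ≤-refl ≡ true)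
proposition2 n k k≤2^n∸1 x = to , from
  where
  k<2^n : k < 2 ^ n
  k<2^n = ≤-trans (s≤s k≤2^n∸1) (≤-reflexive (m+[n∸m]≡n (m^n>0 2 n)))
  H⇔val<k : (H k (negV x) n ≤-refl ≡ true) ⇔ (val x < k)
  H⇔val<k = subst (λ r → (H k (negV x) n ≤-refl ≡ true) ⇔ (val x < r))
                  (m<n⇒m%n≡m {{m^n≢0 2 n}} k<2^n) (H-compares k x n ≤-refl)
  open Equivalence H⇔val<k
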